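{- Let $1\le t\le k\le m\le n$ be integers. For $0\le i\le \frac{n-t}{2}$ and any $r$ with $t\le r\le n$, let $\mathcal F_i(n,r,t)=\{F\subseteq[n]: |F|=r,\ |F\cap[t+2i]|\ge t+i\}$. Then: (1) $\mathcal F_i(n,k,t)=\emptyset$ for all $i>k-t$ (with $i\le\frac{n-t}2$); (2) $\nabla_m(\mathcal F_i(n,k,t))=\mathcal F_i(n,m,t)$ for all integers $0\le i\le\min\bigl(k-t,\frac{n-t}{2}\bigr)$.
   Context: $[n]=\{1,\dots,n\}$. For a family $X$ of subsets of $[n]$, its $m$-shade is $\nabla_m(X)=\{y\subseteq[n]:|y|=m\text{ and }x\subseteq y\text{ for some }x\in X\}$. -}

module Defs where

open import Data.Nat using (ℕ; _+_; _*_; _≤_; _<ᵇ_)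
open import Data.Fin using (Fin; toℕ)
open import Data.Fin.Subset using (Subset; ∣_∣; _∩_; _⊆_)
open import Data.Vec using (tabulate)
open import Data.Product using (Σ; _×_)
open import Relation.Binary.PropositionalEquality using (_≡_)

-- A family of subsets of [n] (elements of [n] are Fin n, j ↦ j+1).
Family : ℕ → Set₁
Family n = Subset n → Set

-- The initial segment [s] = {1,…,s} inside [n], i.e. {j : Fin n | toℕ j < s}.
initSeg : (n s : ℕ) → Subset n
initSeg n s = tabulate (λ j → toℕ j <ᵇ s)

shade : {n : ℕ} → ℕ → Family n → Family n
shade m X y = (∣ y ∣ ≡ m) × Σ (Subset _) (λ x → X x × (x ⊆ y))

𝓕 : (i n r t : ℕ) → Family n
𝓕 i n r t F = (∣ F ∣ ≡ r) × (t + i ≤ ∣ F ∩ initSeg n (t + 2 * i) ∣)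

module Submission where

-- Write S = [t+2i], so F ∈ 𝓕 i n r t means |F| = r and
-- |F ∩ S| ≥ t + i.
--  (1) Since |F ∩ S| ≤ |F|, every member of 𝓕 i n r t satisfies t + i ≤ r;
--      for r = k and i > k - t this is impossible.
--  (2) ⊆: if x ⊆ y then x ∩ S ⊆ y ∩ S, so enlarging a member of
--      𝓕 i n k t to an m-set y keeps |y ∩ S| ≥ t + i.
--      ⊇: given y ∈ 𝓕 i n m t, we must find a k-subset x ⊆ y still meeting S
--      in at least t + i points.  This is the general shrinking lemma below:
--      any y with a ≤ |y ∩ S| and a ≤ k ≤ |y| has a k-subset x with
--      a ≤ |x ∩ S|.  It is proved by scanning y coordinate-wise, keeping an
--      element of y ∩ S whenever one is still needed and an element of y \ S
--      only while room remains beyond the a elements reserved for S.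

open import Defs
open import Data.Nat using (ℕ; zero; suc; _+_; _*_; _≤_; _<_; _∸_; z≤n; s≤s)
open import Data.Nat.Properties
  using (≤-trans; ≤-reflexive; <-irrefl; _≤?_; ≰⇒>; ∸-monoˡ-≤; m≤n+m∸n;
         +-monoʳ-≤; +-monoʳ-<; m+[n∸m]≡n)
open import Data.Fin.Subset using (Subset; ∣_∣; _∩_; _⊆_; inside; outside; ⊥)
open import Data.Fin.Subset.Properties
  using (x∈p∩q⁺; x∈p∩q⁻; p⊆q⇒∣p∣≤∣q∣; ∣p∩q∣≤∣p∣; out⊆; in⊆in; ⊆-refl; ⊥⊆; ∣⊥∣≡0)
open import Data.Vec using (_∷_; [])
open import Data.Product using (_×_; _,_; Σ)
open import Relation.Nullary using (¬_; yes; no)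
open import Relation.Binary.PropositionalEquality using (_≡_; refl; sym; cong)

∩-monoˡ-⊆ : ∀ {n} {x y : Subset n} (S : Subset n) → x ⊆ y → x ∩ S ⊆ y ∩ S
∩-monoˡ-⊆ S x⊆y e∈x∩S =
  let e∈x , e∈S = x∈p∩q⁻ _ _ e∈x∩S in x∈p∩q⁺ (x⊆y e∈x , e∈S)

shrink : ∀ {n} (y S : Subset n) (a k : ℕ) → a ≤ ∣ y ∩ S ∣ → a ≤ k → k ≤ ∣ y ∣ →
  Σ (Subset n) λ x → (∣ x ∣ ≡ k) × (a ≤ ∣ x ∩ S ∣) × (x ⊆ y)
shrink [] [] zero zero _ _ _ = [] , refl , z≤n , ⊆-refl
shrink [] [] (suc a) zero _ () _
shrink [] [] a (suc k) _ _ ()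
shrink (outside ∷ y) (_ ∷ S) a k a≤y∩S a≤k k≤y
  with x , ∣x∣≡k , a≤x∩S , x⊆y ← shrink y S a k a≤y∩S a≤k k≤y
  = outside ∷ x , ∣x∣≡k , a≤x∩S , out⊆ x⊆y
shrink {suc n} (inside ∷ y) (_ ∷ S) zero zero _ _ _ =
  ⊥ , ∣⊥∣≡0 (suc n) , z≤n , ⊥⊆
-- an element of y ∩ S is always worth keeping
shrink (inside ∷ y) (inside ∷ S) a (suc k) a≤y∩S a≤1+k (s≤s k≤y)
  with x , ∣x∣≡k , a-1≤x∩S , x⊆y
         ← shrink y S (a ∸ 1) k (∸-monoˡ-≤ 1 a≤y∩S) (∸-monoˡ-≤ 1 a≤1+k) k≤y
  = inside ∷ x , cong suc ∣x∣≡k , ≤-trans (m≤n+m∸n a 1) (s≤s a-1≤x∩S) , in⊆in x⊆y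
-- an element of y \ S is kept only if the remaining k slots still fit the
-- a required elements of S
shrink (inside ∷ y) (outside ∷ S) a (suc k) a≤y∩S a≤1+k (s≤s k≤y) with a ≤? k
... | yes a≤k
  with x , ∣x∣≡k , a≤x∩S , x⊆y ← shrink y S a k a≤y∩S a≤k k≤y
  = inside ∷ x , cong suc ∣x∣≡k , a≤x∩S , in⊆in x⊆y
... | no a≰k
  -- here a = 1 + k, so the a elements of y ∩ S already give 1 + k ≤ |y|
  with x , ∣x∣≡1+k , a≤x∩S , x⊆y
         ← shrink y S a (suc k) a≤y∩S a≤1+k
             (≤-trans (≰⇒> a≰k) (≤-trans a≤y∩S (∣p∩q∣≤∣p∣ y S)))
  = outside ∷ x , ∣x∣≡1+k , a≤x∩S , out⊆ x⊆y

module _ {n t : ℕ} (i : ℕ) where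

  S : Subset n
  S = initSeg n (t + 2 * i)

  𝓕-size : ∀ {r} (F : Subset n) → 𝓕 i n r t F → t + i ≤ r
  𝓕-size F (∣F∣≡r , t+i≤F∩S) =
    ≤-trans t+i≤F∩S (≤-trans (∣p∩q∣≤∣p∣ F S) (≤-reflexive ∣F∣≡r))

  shade-⊆ : ∀ {k m} (y : Subset n) → shade m (𝓕 i n k t) y → 𝓕 i n m t y
  shade-⊆ y (∣y∣≡m , x , (_ , t+i≤x∩S) , x⊆y) =
    ∣y∣≡m , ≤-trans t+i≤x∩S (p⊆q⇒∣p∣≤∣q∣ (∩-monoˡ-⊆ S x⊆y))

  shade-⊇ : ∀ {k m} → t + i ≤ k → k ≤ m →
    (y : Subset n) → 𝓕 i n m t y → shade m (𝓕 i n k t) y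
  shade-⊇ {k} t+i≤k k≤m y (∣y∣≡m , t+i≤y∩S)
    with x , ∣x∣≡k , t+i≤x∩S , x⊆y
           ← shrink y S (t + i) k t+i≤y∩S t+i≤k (≤-trans k≤m (≤-reflexive (sym ∣y∣≡m)))
    = ∣y∣≡m , x , (∣x∣≡k , t+i≤x∩S) , x⊆y

lemma2p2 : (n m k t : ℕ) → 1 ≤ t → t ≤ k → k ≤ m → m ≤ n →
    ((i : ℕ) → k ∸ t < i → 2 * i ≤ n ∸ t → (F : Subset n) → ¬ 𝓕 i n k t F)
    × ((i : ℕ) → i ≤ k ∸ t → 2 * i ≤ n ∸ t → (y : Subset n) →
        (shade m (𝓕 i n k t) y → 𝓕 i n m t y) × (𝓕 i n m t y → shade m (𝓕 i n k t) y))
lemma2p2 n m k t _ t≤k k≤m _ = empty , shade-equal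
  where
  -- (1) t + i > t + (k - t) ≥ k, contradicting 𝓕-size.
  empty : (i : ℕ) → k ∸ t < i → 2 * i ≤ n ∸ t → (F : Subset n) → ¬ 𝓕 i n k t F
  empty i k-t<i _ F F∈𝓕 =
    <-irrefl refl (≤-trans (+-monoʳ-< t k-t<i) (≤-trans (𝓕-size i F F∈𝓕) (m≤n+m∸n k t)))

  shade-equal : (i : ℕ) → i ≤ k ∸ t → 2 * i ≤ n ∸ t → (y : Subset n) →
    (shade m (𝓕 i n k t) y → 𝓕 i n m t y) × (𝓕 i n m t y → shade m (𝓕 i n k t) y)
  shade-equal i i≤k-t _ y =
    shade-⊆ i y , shade-⊇ i (≤-trans (+-monoʳ-≤ t i≤k-t) (≤-reflexive (m+[n∸m]≡n t≤k))) k≤m y
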